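{- Let $(S,*)$ be an adequate partial semigroup with a two-sided identity $e$, let $A$ be a CR set in $S$, let $F\in\mathcal{P}_f(\mathcal{T})$, and let $L\in\mathcal{P}_f(S)$. Let $\Theta$ be the set of all $M\in\mathcal{P}_f(\mathbb{N})$ such that, writing $M=\{t(1),\dots,t(m)\}$ with $t(1)<\dots<t(m)$, there exists $a\in S^{m+1}$ with $a(1)*f(t(1))*a(2)*\dots*a(m)*f(t(m))*a(m+1)$ defined and in $A\cap\sigma(L)$ for every $f\in F$. Let $k\in\mathbb{N}$ with $|F|\leq k$, and let $r\in\mathbb{N}$ be such that for every $G\in\mathcal{P}_f(\mathcal{T})_{\leq k}$ there exist $m\in\mathbb{N}$, $a\in S^{m+1}$ and $t(1)<\dots<t(m)\leq r$ with $a(1)*g(t(1))*a(2)*\dots*a(m)*g(t(m))*a(m+1)\in A\cap\sigma(L)$ for all $g\in G$. Then $\Theta$ is an $IP_r^*$ set in $(\mathcal{P}_f(\mathbb{N}),\uplus)$.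
   Context: A partial semigroup is a pair $(S,*)$ where $S$ is a nonempty set and $*$ is an operation defined on a nonempty subset of $S\times S$ such that for all $x,y,z\in S$, $(x*y)*z=x*(y*z)$ in the sense that if either side is defined then so is the other and they are equal. A two-sided identity is $e\in S$ with $e*x$ and $x*e$ defined and equal to $x$ for all $x\in S$. For $a\in S$, $\varphi(a)=\{b\in S: a*b \text{ is defined}\}$; for finite nonempty $F\subseteq S$, $\sigma(F)=\bigcap_{a\in F}\varphi(a)$. $(S,*)$ is adequate if $\sigma(F)\neq\emptyset$ for all finite nonempty $F$. $\mathcal{P}_f(X)$ denotes the set of finite nonempty subsets of $X$. Products $\prod_{t\in H}f(t)$ are computed in increasing order of indices. A sequence $f:\mathbb{N}\to S$ is adequate if (i) for each $H\in\mathcal{P}_f(\mathbb{N})$, $\prod_{t\in H}f(t)$ is defined, and (ii) for each $F\in\mathcal{P}_f(S)$ there is $m\in\mathbb{N}$ such that $\prod_{t\in H}f(t)\in\sigma(F)$ for all $H\in\mathcal{P}_f(\mathbb{N})$ with $\min H\geq m$. $\mathcal{T}$ denotes the set of adequate sequences, and $\mathcal{P}_f(\mathcal{T})_{\leq k}=\{F\in\mathcal{P}_f(\mathcal{T}): |F|\leq k\}$. For $k\in\mathbb{N}$, $A\subseteq S$ is a $k$-CR set if for every $L\in\mathcal{P}_f(S)$ there is $r\in\mathbb{N}$ such that for every $F\in\mathcal{P}_f(\mathcal{T})_{\leq k}$ there exist $m\in\mathbb{N}$, $a\in S^{m+1}$ and $t(1)<\dots<t(m)\leq r$ in $\mathbb{N}$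 such that for all $f\in F$, $a(1)*f(t(1))*a(2)*\dots*a(m)*f(t(m))*a(m+1)$ is defined and lies in $A\cap\sigma(L)$; $A$ is a CR set if it is $k$-CR for all $k$. On $\mathcal{P}_f(\mathbb{N})$, $F\uplus G=F\cup G$ is defined iff $\max F<\min G$. A set $C\subseteq\mathcal{P}_f(\mathbb{N})$ is an $IP_r$ set in $(\mathcal{P}_f(\mathbb{N}),\uplus)$ if there exist $X_1,\dots,X_r\in\mathcal{P}_f(\mathbb{N})$ with $\max X_t<\min X_{t+1}$ for $t<r$ and $\bigcup_{t\in H}X_t\in C$ for every $H\in\mathcal{P}_f(\{1,\dots,r\})$; $C$ is an $IP_r^*$ set if it meets every $IP_r$ set. -}

module Defs where

open import Data.Nat using (ℕ; zero; suc; _≤_; _<_)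
open import Data.Fin using (Fin; toℕ) renaming (zero to fzero; suc to fsuc)
open import Data.Fin.Subset using (Subset; Nonempty)
open import Data.Bool using (Bool; true; false; if_then_else_)
open import Data.List using (List; []; _∷_; _++_; length)
open import Data.List.Relation.Unary.All using (All)
open import Data.List.Relation.Unary.Linked using (Linked)
open import Data.Vec using (Vec; []; _∷_)
open import Data.Maybe using (Maybe; just; nothing)
open import Data.Product using (Σ; ∃; _×_; _,_; proj₁)
open import Relation.Binary.PropositionalEquality using (_≡_; _≢_)

-- The partial operation is S → S → Maybe S
-- ('nothing' = undefined).  Its lift to Maybe S makes associativity
-- "(x*y)*z defined iff x*(y*z) defined, and then equal" a single equation.

lift : {S : Set} → (S → S → Maybe S) → Maybe S → Maybe S → Maybe S
lift op (just x) (just y) = op x y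
lift op _        _        = nothing

record PartialSemigroup : Set₁ where
  field
    Carrier  : Set
    op       : Carrier → Carrier → Maybe Carrier
    nonempty : Carrier
    domNonempty : ∃ λ x → ∃ λ y → op x y ≢ nothing
    assoc : ∀ x y z →
      lift op (lift op (just x) (just y)) (just z)
        ≡ lift op (just x) (lift op (just y) (just z))

module _ (P : PartialSemigroup) where
  open PartialSemigroup P renaming (Carrier to S)

  infixl 7 _·_
  _·_ : Maybe S → Maybe S → Maybe S
  _·_ = lift op

  DefIn : Maybe S → (S → Set) → Set
  DefIn m Q = ∃ λ x → m ≡ just x × Q x

  Defined : Maybe S → Set
  Defined m = ∃ λ x → m ≡ just x

  φ : S → S → Set
  φ a b = Defined (op a b)

  σ : List S → S → Set
  σ F b = All (λ a → φ a b) F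

  NonEmptyList : {X : Set} → List X → Set
  NonEmptyList xs = 1 ≤ length xs

  IsAdequate : Set
  IsAdequate = ∀ (F : List S) → NonEmptyList F → ∃ λ b → σ F b

  IsTwoSidedIdentity : S → Set
  IsTwoSidedIdentity e = ∀ x → op e x ≡ just x × op x e ≡ just x

  -- Elements of P_f(ℕ), ℕ = {1,2,...}: canonically represented by
  -- nonempty strictly increasing lists of positive naturals.
  IsPf : List ℕ → Set
  IsPf H = NonEmptyList H × Linked _<_ H × All (λ t → 1 ≤ t) H

  prod : (ℕ → S) → List ℕ → Maybe S
  prod f []            = nothing
  prod f (t ∷ [])      = just (f t)
  prod f (t ∷ u ∷ us)  = just (f t) · prod f (u ∷ us)

  IsAdequateSeq : (ℕ → S) → Set
  IsAdequateSeq f =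
    (∀ H → IsPf H → Defined (prod f H)) ×
    (∀ (F : List S) → NonEmptyList F → ∃ λ m →
       ∀ H → IsPf H → All (λ t → m ≤ t) H → DefIn (prod f H) (σ F))

  𝒯 : Set
  𝒯 = Σ (ℕ → S) IsAdequateSeq

  word : (ℕ → S) → (ts : List ℕ) → Vec S (suc (length ts)) → Maybe S
  word f []       (a ∷ [])  = just a
  word f (t ∷ ts) (a ∷ as)  = just a · (just (f t) · word f ts as)

  GoodWithin : (S → Set) → List S → List 𝒯 → ℕ → Set
  GoodWithin A L G r =
    Σ (List ℕ) λ ts → IsPf ts × All (λ t → t ≤ r) ts ×
    Σ (Vec S (suc (length ts))) λ a →
      All (λ g → DefIn (word (proj₁ g) ts a) (λ x → A x × σ L x)) G

  Is-k-CR : ℕ → (S → Set) → Set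
  Is-k-CR k A = ∀ (L : List S) → NonEmptyList L → ∃ λ r →
    ∀ (G : List 𝒯) → NonEmptyList G → length G ≤ k → GoodWithin A L G r

  IsCR : (S → Set) → Set
  IsCR A = ∀ (k : ℕ) → 1 ≤ k → Is-k-CR k A

  Θ : (S → Set) → List S → List 𝒯 → List ℕ → Set
  Θ A L F M = IsPf M ×
    Σ (Vec S (suc (length M))) λ a →
      All (λ f → DefIn (word (proj₁ f) M a) (λ x → A x × σ L x)) F

-- IP_r and IP_r^* sets in (P_f(ℕ), ⊎).  Subsets of P_f(ℕ) are predicates
-- on List ℕ, only their values at canonical lists (IsPf) matter.

-- ⋃_{t ∈ H} X_t, as the concatenation in increasing order of t (this is
-- the sorted canonical list when max X_t < min X_{t+1}).
unionOver : ∀ {r} → (Fin r → List ℕ) → Subset r → List ℕ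
unionOver {zero}  X []      = []
unionOver {suc r} X (b ∷ H) =
  (if b then X fzero else []) ++ unionOver (λ i → X (fsuc i)) H

IsPfℕ : List ℕ → Set
IsPfℕ H = 1 ≤ length H × Linked _<_ H × All (λ t → 1 ≤ t) H

IsIP : ℕ → (List ℕ → Set) → Set
IsIP r C = Σ (Fin r → List ℕ) λ X →
  (∀ i → IsPfℕ (X i)) ×
  (∀ (i j : Fin r) → toℕ j ≡ suc (toℕ i) →
     All (λ x → All (λ y → x < y) (X j)) (X i)) ×
  (∀ (H : Subset r) → Nonempty H → C (unionOver X H))

IsIPStar : ℕ → (List ℕ → Set) → Set₁
IsIPStar r Θ' = ∀ (C : List ℕ → Set) → IsIP r C →
  ∃ λ M → IsPfℕ M × C M × Θ' M

{-# OPTIONS --safe #-}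

-- The blocks X₁ < ⋯ < X_r of an IP_r set, padded to an infinite block sequence Y, turn every f ∈ F into
-- the adequate sequence t ↦ ∏_{s ∈ Y t} f(s).  The hypothesis on r, applied to these sequences, gives
-- t(1) < ⋯ < t(m) ≤ r, so M = Y t(1) ∪ ⋯ ∪ Y t(m) is a union of X's, and spreading the coefficients
-- over the blocks (filling in e) shows that M ∈ Θ.

module Submission where

open import Defs
open import Data.Nat using (ℕ; zero; suc; pred; _+_; _≤_; _<_; z≤n; s≤s)
open import Data.Nat.Properties
open import Data.Fin using (Fin; toℕ) renaming (zero to fzero; suc to fsuc)
open import Data.Fin.Subset using (Subset; Nonempty)
open import Data.Bool using (true; false)
open import Data.Vec using (Vec; []; _∷_; here; there)
open import Data.List using (List; []; _∷_; _++_; length; map; concatMap)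
open import Data.List.Properties using (length-map; ++-identityʳ)
open import Data.List.Extrema.Nat using (max; xs≤max; ⊥≤max)
open import Data.List.Relation.Unary.All as All using (All; []; _∷_)
import Data.List.Relation.Unary.All.Properties as All
open import Data.List.Relation.Unary.AllPairs as AllPairs using (AllPairs; []; _∷_)
import Data.List.Relation.Unary.AllPairs.Properties as AllPairs
open import Data.List.Relation.Unary.Linked as Linked using (Linked; []; [-]; _∷_)
open import Data.List.Relation.Unary.Linked.Properties using (Linked⇒All; Linked⇒AllPairs; AllPairs⇒Linked)
open import Data.Maybe using (Maybe; just; nothing)
open import Data.Product using (∃; _×_; _,_; proj₁; proj₂)
open import Data.Sum using (inj₁; inj₂)
open import Data.Empty using (⊥-elim)
open import Function using (_∘_)
open import Relation.Binary.PropositionalEquality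
open ≡-Reasoning

infix 4 _≪_

_≪_ : List ℕ → List ℕ → Set
xs ≪ ys = All (λ x → All (x <_) ys) xs

≪-trans : ∀ {xs ys zs} → 1 ≤ length ys → xs ≪ ys → ys ≪ zs → xs ≪ zs
≪-trans {ys = _ ∷ _} _ xs≪ys (y<zs ∷ _) =
  All.map (λ x<ys → All.map (<-trans (All.head x<ys)) y<zs) xs≪ys

++-nonempty : ∀ {A : Set} (xs ys : List A) → 1 ≤ length xs → 1 ≤ length (xs ++ ys)
++-nonempty (_ ∷ _) _ _ = s≤s z≤n

-- Y 0 is a junk block: only the blocks with positive index are ordered.
record IsBlockSeq (Y : ℕ → List ℕ) : Set where
  field
    block-pf : ∀ t → IsPfℕ (Y t)
    block-step : ∀ t → 1 ≤ t → Y t ≪ Y (suc t)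
    block-eventually-above : ∀ m → ∃ λ n → ∀ t → n ≤ t → All (m ≤_) (Y t)

  block-nonempty : ∀ t → 1 ≤ length (Y t)
  block-nonempty t = proj₁ (block-pf t)

  block-increasing : ∀ {s t} → 1 ≤ s → s < t → Y s ≪ Y t
  block-increasing {s} {suc t} 1≤s s<1+t with m<1+n⇒m<n∨m≡n s<1+t
  ... | inj₂ refl = block-step s 1≤s
  ... | inj₁ s<t  = ≪-trans (block-nonempty t)
                      (block-increasing 1≤s s<t) (block-step t (≤-trans 1≤s (<⇒≤ s<t)))

  blocks-ordered : ∀ {H} → AllPairs _<_ H → All (1 ≤_) H → AllPairs (λ s t → Y s ≪ Y t) H
  blocks-ordered [] [] = []
  blocks-ordered (t<H ∷ <H) (1≤t ∷ 1≤H) =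
    All.map (block-increasing 1≤t) t<H ∷ blocks-ordered <H 1≤H

  concatMap-pf : ∀ {H} → IsPfℕ H → IsPfℕ (concatMap Y H)
  concatMap-pf {t ∷ H} (_ , H-linked , 1≤H) =
    ++-nonempty (Y t) (concatMap Y H) (block-nonempty t) ,
    AllPairs⇒Linked (AllPairs.concat⁺
      (All.map⁺ (All.universal (λ u → Linked⇒AllPairs <-trans (proj₁ (proj₂ (block-pf u)))) _))
      (AllPairs.map⁺ (blocks-ordered (Linked⇒AllPairs <-trans H-linked) 1≤H))) ,
    All.concat⁺ (All.map⁺ (All.universal (λ u → proj₂ (proj₂ (block-pf u))) (t ∷ H)))

  concatMap-eventually-above : ∀ m → ∃ λ n → ∀ H → All (n ≤_) H → All (m ≤_) (concatMap Y H)
  concatMap-eventually-above m =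
    let (n , above) = block-eventually-above m
    in n , λ H n≤H → All.concat⁺ (All.map⁺ (All.map (above _) n≤H))

module _ (P : PartialSemigroup) where
  open PartialSemigroup P renaming (Carrier to S)

  infixl 7 _∙_
  _∙_ : Maybe S → Maybe S → Maybe S
  _∙_ = _·_ P

  ∙-assoc : ∀ a b c → (a ∙ b) ∙ c ≡ a ∙ (b ∙ c)
  ∙-assoc (just x) (just y) (just z) = assoc x y z
  ∙-assoc (just x) (just y) nothing with op x y
  ... | just _  = refl
  ... | nothing = refl
  ∙-assoc (just _) nothing  _ = refl
  ∙-assoc nothing  _        _ = refl

  prod-++ : ∀ f xs ys → 1 ≤ length xs → 1 ≤ length ys →
            prod P f (xs ++ ys) ≡ prod P f xs ∙ prod P f ys
  prod-++ f (x ∷ []) ys@(_ ∷ _) _ _ = refl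
  prod-++ f (x ∷ xs@(_ ∷ _)) ys _ ys≠[] = begin
    just (f x) ∙ prod P f (xs ++ ys)           ≡⟨ cong (just (f x) ∙_) (prod-++ f xs ys (s≤s z≤n) ys≠[]) ⟩
    just (f x) ∙ (prod P f xs ∙ prod P f ys)   ≡⟨ ∙-assoc (just (f x)) (prod P f xs) (prod P f ys) ⟨
    prod P f (x ∷ xs) ∙ prod P f ys            ∎

  module _ {f g : ℕ → S} {Y : ℕ → List ℕ}
           (f-on-blocks : ∀ t → prod P f (Y t) ≡ just (g t))
           (Y-nonempty : ∀ t → 1 ≤ length (Y t)) where

    prod-concatMap : ∀ H → 1 ≤ length H → prod P g H ≡ prod P f (concatMap Y H)
    prod-concatMap (t ∷ []) _ = begin
      just (g t)           ≡⟨ f-on-blocks t ⟨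
      prod P f (Y t)       ≡⟨ cong (prod P f) (++-identityʳ (Y t)) ⟨
      prod P f (Y t ++ []) ∎
    prod-concatMap (t ∷ H@(u ∷ _)) _ = begin
      just (g t) ∙ prod P g H                  ≡⟨ cong₂ _∙_ (sym (f-on-blocks t)) (prod-concatMap H (s≤s z≤n)) ⟩
      prod P f (Y t) ∙ prod P f (concatMap Y H) ≡⟨ prod-++ f (Y t) _ (Y-nonempty t) (++-nonempty (Y u) _ (Y-nonempty u)) ⟨
      prod P f (concatMap Y (t ∷ H))           ∎

  module _ {Y : ℕ → List ℕ} (Y-blocks : IsBlockSeq Y) where
    open IsBlockSeq Y-blocks

    blockProduct : 𝒯 P → ℕ → S
    blockProduct (f , f-defined , _) t = proj₁ (f-defined (Y t) (block-pf t))

    prod-block : ∀ f t → prod P (proj₁ f) (Y t) ≡ just (blockProduct f t)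
    prod-block (f , f-defined , _) t = proj₂ (f-defined (Y t) (block-pf t))

    blockProduct-adequate : ∀ f → IsAdequateSeq P (blockProduct f)
    blockProduct-adequate f@(_ , f-defined , f-tail) =
      (λ H H-pf → subst (Defined P) (sym (prod-concat H (proj₁ H-pf)))
                    (f-defined (concatMap Y H) (concatMap-pf H-pf))) ,
      λ L L≠[] →
        let (m , tail-in-σ) = f-tail L L≠[]
            (n , above)     = concatMap-eventually-above m
        in n , λ H H-pf n≤H → subst (λ p → DefIn P p (σ P L)) (sym (prod-concat H (proj₁ H-pf)))
                                (tail-in-σ (concatMap Y H) (concatMap-pf H-pf) (above H n≤H))
      where
      prod-concat : ∀ H → 1 ≤ length H → prod P (blockProduct f) H ≡ prod P (proj₁ f) (concatMap Y H)
      prod-concat = prod-concatMap (prod-block f) block-nonempty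

    blockSubsequence : 𝒯 P → 𝒯 P
    blockSubsequence f = blockProduct f , blockProduct-adequate f

  module _ (e : S) (e-identity : IsTwoSidedIdentity P e) where

    e-identityˡ : ∀ m → just e ∙ m ≡ m
    e-identityˡ (just x) = proj₁ (e-identity x)
    e-identityˡ nothing  = refl

    blockCoeffs : S → (b rest : List ℕ) → Vec S (suc (length rest)) → Vec S (suc (length (b ++ rest)))
    blockCoeffs a []       rest v = v
    blockCoeffs a (_ ∷ xs) rest v = a ∷ blockCoeffs e xs rest v

    word-blockCoeffs : ∀ f a b rest v → 1 ≤ length b →
      word P f (b ++ rest) (blockCoeffs a b rest v) ≡ just a ∙ (prod P f b ∙ word P f rest v)
    word-blockCoeffs f a (x ∷ []) rest v _ = refl
    word-blockCoeffs f a (x ∷ xs@(_ ∷ _)) rest v _ = cong (just a ∙_) (begin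
      just (f x) ∙ word P f (xs ++ rest) (blockCoeffs e xs rest v)
        ≡⟨ cong (just (f x) ∙_) (trans (word-blockCoeffs f e xs rest v (s≤s z≤n))
                                         (e-identityˡ (prod P f xs ∙ word P f rest v))) ⟩
      just (f x) ∙ (prod P f xs ∙ word P f rest v)
        ≡⟨ ∙-assoc (just (f x)) (prod P f xs) (word P f rest v) ⟨
      prod P f (x ∷ xs) ∙ word P f rest v ∎)

    spread : (Y : ℕ → List ℕ) (ts : List ℕ) → Vec S (suc (length ts)) → Vec S (suc (length (concatMap Y ts)))
    spread Y []       (a ∷ []) = a ∷ []
    spread Y (t ∷ ts) (a ∷ as) = blockCoeffs a (Y t) (concatMap Y ts) (spread Y ts as)

    word-spread : ∀ {f g : ℕ → S} {Y : ℕ → List ℕ} →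
      (∀ t → prod P f (Y t) ≡ just (g t)) → (∀ t → 1 ≤ length (Y t)) →
      ∀ ts a → word P f (concatMap Y ts) (spread Y ts a) ≡ word P g ts a
    word-spread f-on-blocks Y-nonempty []       (a ∷ []) = refl
    word-spread {f} {g} {Y} f-on-blocks Y-nonempty (t ∷ ts) (a ∷ as) = begin
      word P f (Y t ++ concatMap Y ts) (blockCoeffs a (Y t) (concatMap Y ts) (spread Y ts as))
        ≡⟨ word-blockCoeffs f a (Y t) _ _ (Y-nonempty t) ⟩
      just a ∙ (prod P f (Y t) ∙ word P f (concatMap Y ts) (spread Y ts as))
        ≡⟨ cong₂ (λ u w → just a ∙ (u ∙ w)) (f-on-blocks t) (word-spread f-on-blocks Y-nonempty ts as) ⟩
      just a ∙ (just (g t) ∙ word P g ts as) ∎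

    Θ-concatMap : ∀ {Y} (Y-blocks : IsBlockSeq Y) A L F ts → IsPfℕ ts → (a : Vec S (suc (length ts))) →
      All (λ g → DefIn P (word P (proj₁ g) ts a) (λ x → A x × σ P L x)) (map (blockSubsequence Y-blocks) F) →
      Θ P A L F (concatMap Y ts)
    Θ-concatMap {Y} Y-blocks A L F ts ts-pf a words =
      concatMap-pf ts-pf , spread Y ts a ,
      All.map (λ {f} → subst (λ w → DefIn P w _)
                 (sym (word-spread (prod-block Y-blocks f) block-nonempty ts a)))
              (All.map⁻ words)
      where open IsBlockSeq Y-blocks

IncreasingFamily : ∀ {r} → (Fin r → List ℕ) → Set
IncreasingFamily {r} X = ∀ (i j : Fin r) → toℕ j ≡ suc (toℕ i) → X i ≪ X j

IncreasingFamily-tail : ∀ {r} {X : Fin (suc r) → List ℕ} → IncreasingFamily X → IncreasingFamily (X ∘ fsuc)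
IncreasingFamily-tail X-inc i j j≡1+i = X-inc (fsuc i) (fsuc j) (cong suc j≡1+i)

upper-bound : ∀ {r} (X : Fin r → List ℕ) → ∃ λ N → ∀ i → All (_≤ N) (X i)
upper-bound {zero}  X = 0 , λ ()
upper-bound {suc r} X =
  let (N , X≤N) = upper-bound (X ∘ fsuc)
  in max N (X fzero) , λ { fzero → xs≤max N (X fzero)
                         ; (fsuc i) → All.map (λ x≤N → ≤-trans x≤N (⊥≤max N (X fzero))) (X≤N i) }

module _ (N : ℕ) where

  -- Block t of X sits at index t (indices 1, …, r); the other indices get singletons above N.
  extend : ∀ {r} → (Fin r → List ℕ) → ℕ → List ℕ
  extend {zero}  X t             = suc (t + N) ∷ []
  extend {suc r} X zero          = extend (X ∘ fsuc) zero
  extend {suc r} X (suc zero)    = X fzero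
  extend {suc r} X (suc (suc t)) = extend (X ∘ fsuc) (suc t)

  extend-pf : ∀ {r} (X : Fin r → List ℕ) → (∀ i → IsPfℕ (X i)) → ∀ t → IsPfℕ (extend X t)
  extend-pf {zero}  X X-pf t             = s≤s z≤n , [-] , s≤s z≤n ∷ []
  extend-pf {suc r} X X-pf zero          = extend-pf (X ∘ fsuc) (X-pf ∘ fsuc) zero
  extend-pf {suc r} X X-pf (suc zero)    = X-pf fzero
  extend-pf {suc r} X X-pf (suc (suc t)) = extend-pf (X ∘ fsuc) (X-pf ∘ fsuc) (suc t)

  extend-step : ∀ {r} (X : Fin r → List ℕ) → IncreasingFamily X → (∀ i → All (_≤ N) (X i)) →
                ∀ t → 1 ≤ t → extend X t ≪ extend X (suc t)
  extend-step {zero} X _ _ t _ = (n<1+n _ ∷ []) ∷ []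
  extend-step {suc zero} X _ X≤N (suc zero) _ =
    All.map (λ x≤N → s≤s (≤-trans x≤N (n≤1+n N)) ∷ []) (X≤N fzero)
  extend-step {suc (suc r)} X X-inc _ (suc zero) _ = X-inc fzero (fsuc fzero) refl
  extend-step {suc r} X X-inc X≤N (suc (suc t)) _ =
    extend-step (X ∘ fsuc) (IncreasingFamily-tail X-inc) (X≤N ∘ fsuc) (suc t) (s≤s z≤n)

  extend-above : ∀ {r} (X : Fin r → List ℕ) t → All (λ x → t ≤ r + x) (extend X t)
  extend-above {zero}  X t             = ≤-trans (m≤m+n t N) (n≤1+n (t + N)) ∷ []
  extend-above {suc r} X zero          = All.universal (λ _ → z≤n) _
  extend-above {suc r} X (suc zero)    = All.universal (λ _ → s≤s z≤n) _
  extend-above {suc r} X (suc (suc t)) = All.map s≤s (extend-above (X ∘ fsuc) (suc t))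

  extend-isBlockSeq : ∀ {r} (X : Fin r → List ℕ) → (∀ i → IsPfℕ (X i)) → IncreasingFamily X →
                      (∀ i → All (_≤ N) (X i)) → IsBlockSeq (extend X)
  extend-isBlockSeq {r} X X-pf X-inc X≤N = record
    { block-pf               = extend-pf X X-pf
    ; block-step             = extend-step X X-inc X≤N
    ; block-eventually-above = λ m → r + m , λ t r+m≤t →
        All.map (λ t≤r+x → +-cancelˡ-≤ r m _ (≤-trans r+m≤t t≤r+x)) (extend-above X t)
    }

-- For increasing ts, select ts = {i : suc (toℕ i) ∈ ts}.
select : ∀ {r} → List ℕ → Subset r
select {zero}  _        = []
select {suc r} (1 ∷ ts) = true ∷ select (map pred ts)
select {suc r} ts       = false ∷ select (map pred ts)

pred-linked : ∀ {ts} → Linked _<_ ts → All (2 ≤_) ts → Linked _<_ (map pred ts)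
pred-linked []           _                    = []
pred-linked [-]          _                    = [-]
pred-linked (s≤s x<y ∷ y<ts) (s≤s (s≤s _) ∷ 2≤ts) = x<y ∷ pred-linked y<ts 2≤ts

module _ (N : ℕ) where

  concatMap-extend-pred : ∀ {r} (X : Fin (suc r) → List ℕ) ts → All (2 ≤_) ts →
                          concatMap (extend N X) ts ≡ concatMap (extend N (X ∘ fsuc)) (map pred ts)
  concatMap-extend-pred X []                 []       = refl
  concatMap-extend-pred X (suc (suc t) ∷ ts) (s≤s (s≤s _) ∷ 2≤ts) =
    cong (extend N (X ∘ fsuc) (suc t) ++_) (concatMap-extend-pred X ts 2≤ts)

  unionOver-select : ∀ {r} (X : Fin r → List ℕ) ts → Linked _<_ ts → All (1 ≤_) ts → All (_≤ r) ts →
                     unionOver X (select ts) ≡ concatMap (extend N X) ts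

  unionOver-select-pred : ∀ {r} (X : Fin (suc r) → List ℕ) ts → Linked _<_ ts → All (2 ≤_) ts → All (_≤ suc r) ts →
                          unionOver (X ∘ fsuc) (select (map pred ts)) ≡ concatMap (extend N X) ts
  unionOver-select-pred X ts ts-linked 2≤ts ts≤1+r = begin
    unionOver (X ∘ fsuc) (select (map pred ts))
      ≡⟨ unionOver-select (X ∘ fsuc) (map pred ts) (pred-linked ts-linked 2≤ts)
           (All.map⁺ (All.map pred-mono-≤ 2≤ts)) (All.map⁺ (All.map pred-mono-≤ ts≤1+r)) ⟩
    concatMap (extend N (X ∘ fsuc)) (map pred ts)
      ≡⟨ concatMap-extend-pred X ts 2≤ts ⟨
    concatMap (extend N X) ts ∎

  unionOver-select {zero}  X []      _ _           _           = refl
  unionOver-select {zero}  X (_ ∷ _) _ (1≤t ∷ _)   (t≤0 ∷ _)   = ⊥-elim (<-irrefl refl (≤-trans 1≤t t≤0))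
  unionOver-select {suc r} X []      _ _           _           = unionOver-select (X ∘ fsuc) [] [] [] []
  unionOver-select {suc r} X (0 ∷ _) _ (() ∷ _) _
  unionOver-select {suc r} X (1 ∷ ts) 1<ts _ (_ ∷ ts≤1+r) =
    cong (X fzero ++_) (unionOver-select-pred X ts (Linked.tail 1<ts)
                          (AllPairs.head (Linked⇒AllPairs <-trans 1<ts)) ts≤1+r)
  unionOver-select {suc r} X ts@(suc (suc _) ∷ _) ts-linked _ ts≤1+r =
    unionOver-select-pred X ts ts-linked (Linked⇒All <-trans (s≤s (s≤s z≤n)) ts-linked) ts≤1+r

unionOver-nonempty : ∀ {r} (X : Fin r → List ℕ) H → 1 ≤ length (unionOver X H) → Nonempty H
unionOver-nonempty {suc r} X (true  ∷ H) _ = fzero , here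
unionOver-nonempty {suc r} X (false ∷ H) nonempty =
  let (i , i∈H) = unionOver-nonempty (X ∘ fsuc) H nonempty in fsuc i , there i∈H

concatMap-extend-∈ : ∀ N {r} {C : List ℕ → Set} (X : Fin r → List ℕ) → (∀ i → IsPfℕ (X i)) →
                     (∀ H → Nonempty H → C (unionOver X H)) →
                     ∀ {ts} → IsPfℕ ts → All (_≤ r) ts → C (concatMap (extend N X) ts)
concatMap-extend-∈ N {C = C} X X-pf C∋ {t ∷ ts} (_ , ts-linked , 1≤ts) ts≤r =
  subst C union (C∋ (select (t ∷ ts)) (unionOver-nonempty X _ (subst (λ M → 1 ≤ length M) (sym union)
    (++-nonempty (extend N X t) _ (proj₁ (extend-pf N X X-pf t))))))
  where union = unionOver-select N X (t ∷ ts) ts-linked 1≤ts ts≤r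

lemma4p9 : (P : PartialSemigroup) → IsAdequate P →
    (e : PartialSemigroup.Carrier P) → IsTwoSidedIdentity P e →
    (A : PartialSemigroup.Carrier P → Set) → IsCR P A →
    (F : List (𝒯 P)) → NonEmptyList P F →
    (L : List (PartialSemigroup.Carrier P)) → NonEmptyList P L →
    (k : ℕ) → 1 ≤ k → length F ≤ k →
    (r : ℕ) → 1 ≤ r →
    (∀ (G : List (𝒯 P)) → NonEmptyList P G → length G ≤ k → GoodWithin P A L G r) →
    IsIPStar r (Θ P A L F)
lemma4p9 P _ e e-identity A _ F F≠[] L _ k _ |F|≤k r _ good-within C (X , X-pf , X-inc , C∋) =
  let (ts , ts-pf , ts≤r , a , words) = good-within G G≠[] |G|≤k
  in concatMap Y ts , concatMap-pf ts-pf ,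
     concatMap-extend-∈ N {C = C} X X-pf C∋ ts-pf ts≤r ,
     Θ-concatMap P e e-identity Y-blocks A L F ts ts-pf a words
  where
  N : ℕ
  N = proj₁ (upper-bound X)
  Y : ℕ → List ℕ
  Y = extend N X
  Y-blocks : IsBlockSeq Y
  Y-blocks = extend-isBlockSeq N X X-pf X-inc (proj₂ (upper-bound X))
  open IsBlockSeq Y-blocks
  G : List (𝒯 P)
  G = map (blockSubsequence P Y-blocks) F
  G≠[] : NonEmptyList P G
  G≠[] = subst (1 ≤_) (sym (length-map _ F)) F≠[]
  |G|≤k : length G ≤ k
  |G|≤k = subst (_≤ k) (sym (length-map _ F)) |F|≤k
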